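{- For every fixed positive integer $k$, $\chi_L(S_n(k))=\Theta\left(n^{1/k}\right)$ as $n\to\infty$; that is, there exist constants $A,B>0$ such that $A n^{1/k}\leq \chi_L(S_n(k))\leq B n^{1/k}$ for all sufficiently large $n$.
   Context: For a simple connected graph $G=(V,E)$, a $k$-coloring is a map $c:V\to\{1,\dots,k\}$ with adjacent vertices receiving different colors; $c^{ -1}(i)$ denotes the $i$-th color class, and $d(u,S)=\min_{v\in S}d(u,v)$. The color code of $v$ is $r_c(v)=(d(v,c^{ -1}(1)),\dots,d(v,c^{ -1}(k)))$. The coloring $c$ is a locating coloring if distinct vertices have distinct color codes. The locating chromatic number $\chi_L(G)$ is the least $k$ such that $G$ has a locating $k$-coloring. For $n\geq 2$ and positive integers $a_1,\dots,a_n$, the palm $S_n(a_1,\dots,a_n)$ is the tree consisting of $n$ paths of lengths $a_1,\dots,a_n$ sharing one common endpoint (the hub), otherwise disjoint. The regular palm is $S_n(k)=S_n(k,k,\dots,k)$. -}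

module Defs where

open import Data.Nat using (ℕ; zero; suc; _+_; _≤_)
open import Data.Fin using (Fin; toℕ)
open import Data.Product using (Σ; _×_; _,_)
open import Data.Sum using (_⊎_)
open import Relation.Nullary using (¬_)
open import Relation.Binary.PropositionalEquality using (_≡_; _≢_)

data Walk {V : Set} (Adj : V → V → Set) : V → V → ℕ → Set where
  here : ∀ {u} → Walk Adj u u 0
  step : ∀ {u w v l} → Adj u w → Walk Adj w v l → Walk Adj u v (suc l)

Dist : {V : Set} → (V → V → Set) → V → V → ℕ → Set
Dist Adj u v d = Walk Adj u v d × (∀ l → Walk Adj u v l → d ≤ l)

Proper : {V : Set} → (V → V → Set) → {m : ℕ} → (V → Fin m) → Set
Proper {V} Adj c = ∀ {u v : V} → Adj u v → c u ≢ c v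

-- d(u, c⁻¹(i)) = d : some vertex of color i is at distance d from u,
-- and every vertex of color i is at distance ≥ d.
-- (If the class c⁻¹(i) is empty, no d satisfies this: distance ∞.)
ClassDist : {V : Set} → (V → V → Set) → {m : ℕ} → (V → Fin m) →
            V → Fin m → ℕ → Set
ClassDist {V} Adj c u i d =
  Σ V (λ v → c v ≡ i × Dist Adj u v d) ×
  (∀ (v : V) d' → c v ≡ i → Dist Adj u v d' → d ≤ d')

SameCode : {V : Set} → (V → V → Set) → {m : ℕ} → (V → Fin m) → V → V → Set
SameCode Adj c u v = ∀ i d → (ClassDist Adj c u i d → ClassDist Adj c v i d)
                           × (ClassDist Adj c v i d → ClassDist Adj c u i d)

Locating : {V : Set} → (V → V → Set) → {m : ℕ} → (V → Fin m) → Set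
Locating Adj c = Proper Adj c × (∀ u v → SameCode Adj c u v → u ≡ v)

IsLocChromNum : {V : Set} → (V → V → Set) → ℕ → Set
IsLocChromNum {V} Adj m =
  Σ (V → Fin m) (Locating Adj) ×
  (∀ m' → suc m' ≤ m → (c : V → Fin m') → ¬ Locating Adj c)

-- The regular palm S_n(k): a hub and n paths of length k.
-- node i j is the vertex on the i-th path at distance (toℕ j + 1) from hub.

data PalmV (n k : ℕ) : Set where
  hub  : PalmV n k
  node : Fin n → Fin k → PalmV n k

data PalmEdge {n k : ℕ} : PalmV n k → PalmV n k → Set where
  e-hub  : ∀ i j → toℕ j ≡ 0 → PalmEdge hub (node i j)
  e-path : ∀ i j j' → suc (toℕ j) ≡ toℕ j' → PalmEdge (node i j) (node i j')

PalmAdj : (n k : ℕ) → PalmV n k → PalmV n k → Set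
PalmAdj n k u v = PalmEdge u v ⊎ PalmEdge v u

-- Lower bound: if two legs carry the same word of colours, the automorphism swapping them
-- preserves the colouring, so their vertices at equal depth get equal codes. Hence a locating
-- χ-colouring gives the n legs distinct words of length k over χ colours, and n ≤ χ ^ k.
-- Upper bound: if n ≤ q ^ k, give the legs distinct words w_i and colour the vertex of leg i at
-- depth j by the pair (j, w_i j), with one more colour for the hub. Equally coloured vertices lie
-- at the same depth j on legs i ≠ i′, and a position p where w_i and w_i′ differ yields a colour
-- class at distance ∣j - p∣ from the first but at distance j + p + 2 from the second.
-- Taking q least gives χ ≤ 1 + k q ≤ 4k (q - 1) and (q - 1) ^ k < n. As χ_L is an exact minimum,
-- its existence comes from deciding, by finite search, which numbers of colours suffice.

module Submission where

open import Defs
open import Data.Nat using (ℕ; zero; suc; _+_; _*_; _^_; _≤_; _<_; z≤n; s≤s; s≤s⁻¹; ∣_-_∣)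
open import Data.Nat.Properties
open import Data.Fin using (Fin; toℕ; fromℕ; fromℕ<; inject≤; combine; remQuot; funToFin; finToFun)
  renaming (zero to fzero; suc to fsuc)
open import Data.Fin.Properties
  using (toℕ-injective; toℕ<n; toℕ-fromℕ; toℕ-fromℕ<; toℕ-inject; any?; all?; ¬∀⟶∃¬-smallest; ¬∀⟶∃¬;
         remQuot-combine; combine-injective; funToFin-finToFin; finToFun-funToFin; injective⇒≤;
         inject≤-injective)
  renaming (_≟_ to _≟ᶠ_; suc-injective to fsuc-injective)
open import Data.Fin.Permutation using (Permutation′; transpose; _⟨$⟩ʳ_; _⟨$⟩ˡ_; inverseˡ; inverseʳ)
open import Data.Product using (Σ; _×_; _,_; proj₁; proj₂; uncurry)
open import Data.Sum using (inj₁; inj₂)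
import Data.Sum as Sum
open import Function using (_∘_)
open import Relation.Nullary using (¬_; Dec; yes; no; contradiction)
open import Relation.Nullary.Decidable using (map′; _×-dec_; _⊎-dec_; _→-dec_; ¬?; decidable-stable)
open import Relation.Binary.PropositionalEquality
open import Data.Nat.Tactic.RingSolver using (solve-∀)

least-satisfying : {P : ℕ → Set} → (∀ q → Dec (P q)) → ∀ {B} → P B →
                   Σ ℕ λ q → P q × q ≤ B × (∀ q′ → q′ < q → ¬ P q′)
least-satisfying {P} P? {B} pB
  with i , ¬¬Pi , below ← ¬∀⟶∃¬-smallest (suc B) (λ i → ¬ P (toℕ i)) (λ i → ¬? (P? (toℕ i)))
                              (λ none → none (fromℕ B) (subst P (sym (toℕ-fromℕ B)) pB))
  = toℕ i , decidable-stable (P? (toℕ i)) ¬¬Pi , s≤s⁻¹ (toℕ<n i) ,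
    λ q′ q′<i → subst (λ q → ¬ P q) (trans (toℕ-inject (fromℕ< q′<i)) (toℕ-fromℕ< q′<i))
                      (below (fromℕ< q′<i))

∣n-1+n∣≡1 : ∀ n → ∣ n - suc n ∣ ≡ 1
∣n-1+n∣≡1 zero    = refl
∣n-1+n∣≡1 (suc n) = ∣n-1+n∣≡1 n

∣-∣-step : ∀ a b c → ∣ a - b ∣ ≡ 1 → ∣ a - c ∣ ≤ suc ∣ b - c ∣
∣-∣-step a b c ∣a-b∣≡1 = subst (λ s → ∣ a - c ∣ ≤ s + ∣ b - c ∣) ∣a-b∣≡1 (∣-∣-triangle a b c)

∣-∣<1+m+1+n : ∀ m n → ∣ m - n ∣ < suc m + suc n
∣-∣<1+m+1+n m n = s≤s (≤-trans (∣m-n∣≤m⊔n m n) (≤-trans (m⊔n≤m+n m n) (+-monoʳ-≤ m (n≤1+n n))))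

^-distribʳ-* : ∀ m n o → (m * n) ^ o ≡ m ^ o * n ^ o
^-distribʳ-* m n zero    = refl
^-distribʳ-* m n (suc o) = begin
  m * n * (m * n) ^ o     ≡⟨ cong (m * n *_) (^-distribʳ-* m n o) ⟩
  m * n * (m ^ o * n ^ o) ≡⟨ [m*n]*[o*p]≡[m*o]*[n*p] m n (m ^ o) (n ^ o) ⟩
  m * m ^ o * (n * n ^ o) ∎
  where open ≡-Reasoning

1+k[2+r]≤4k[1+r] : ∀ {k} r → 0 < k → suc (k * (2 + r)) ≤ 4 * k * suc r
1+k[2+r]≤4k[1+r] {suc k′} r _ = subst (suc (suc k′ * (2 + r)) ≤_) (slack k′ r) (m≤m+n _ _)
  where
  slack : ∀ k′ r → suc (suc k′ * (2 + r)) + (1 + 2 * k′ + 3 * suc k′ * r) ≡ 4 * suc k′ * suc r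
  slack = solve-∀

root-bracket : ∀ {n k} → 0 < k → 2 ≤ n → Σ ℕ λ r → n ≤ (2 + r) ^ k × (1 + r) ^ k < n
root-bracket {n@(suc _)} {k@(suc _)} 0<k 2≤n
  with least-satisfying (λ q → n ≤? q ^ k) (subst (_≤ n ^ k) (*-identityʳ n) (^-monoʳ-≤ n 0<k))
... | 0 , n≤0^k , _ = contradiction (≤-trans 2≤n n≤0^k) λ ()
... | 1 , n≤1^k , _ = contradiction (≤-trans 2≤n (≤-trans n≤1^k (≤-reflexive (^-zeroˡ k)))) λ { (s≤s ()) }
... | suc (suc r) , n≤q^k , _ , smaller = r , n≤q^k , ≰⇒> (smaller (suc r) ≤-refl)

χ^k≤[4k]^k*n : ∀ {n k r χ} → 0 < k → χ ≤ suc (k * (2 + r)) → (1 + r) ^ k < n → χ ^ k ≤ (4 * k) ^ k * n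
χ^k≤[4k]^k*n {n} {k} {r} {χ} 0<k χ≤1+k[2+r] [1+r]^k<n = begin
  χ ^ k                   ≤⟨ ^-monoˡ-≤ k χ≤1+k[2+r] ⟩
  suc (k * (2 + r)) ^ k   ≤⟨ ^-monoˡ-≤ k (1+k[2+r]≤4k[1+r] r 0<k) ⟩
  (4 * k * suc r) ^ k     ≡⟨ ^-distribʳ-* (4 * k) (suc r) k ⟩
  (4 * k) ^ k * suc r ^ k ≤⟨ *-monoʳ-≤ ((4 * k) ^ k) (<⇒≤ [1+r]^k<n) ⟩
  (4 * k) ^ k * n         ∎
  where open ≤-Reasoning

transpose-from : ∀ {n} (i j : Fin n) → transpose i j ⟨$⟩ʳ i ≡ j
transpose-from i j with i ≟ᶠ i
... | yes _   = refl
... | no i≢i = contradiction refl i≢i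

transpose-resp : ∀ {n} {A : Set} (g : Fin n → A) {i j} → g i ≡ g j → ∀ l → g (transpose i j ⟨$⟩ʳ l) ≡ g l
transpose-resp g {i} {j} gi≡gj l with l ≟ᶠ i
... | yes refl = sym gi≡gj
... | no _ with l ≟ᶠ j
...   | yes refl = gi≡gj
...   | no _     = refl

InjectiveWords : ∀ {n k m} → (Fin n → Fin k → Fin m) → Set
InjectiveWords w = ∀ {i i′} → (∀ j → w i j ≡ w i′ j) → i ≡ i′

funToFin-cong : ∀ {k m} {f g : Fin k → Fin m} → (∀ j → f j ≡ g j) → funToFin f ≡ funToFin g
funToFin-cong {zero}  _   = refl
funToFin-cong {suc k} f≗g = cong₂ combine (f≗g fzero) (funToFin-cong (f≗g ∘ fsuc))

InjectiveWords⇒≤ : ∀ {n k m} {w : Fin n → Fin k → Fin m} → InjectiveWords w → n ≤ m ^ k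
InjectiveWords⇒≤ {w = w} inj = injective⇒≤ {f = funToFin ∘ w} λ {i} {i′} eq → inj λ j →
  trans (sym (finToFun-funToFin (w i) j))
        (trans (cong (λ f → finToFun f j) eq) (finToFun-funToFin (w i′) j))

≤⇒InjectiveWords : ∀ {n k m} → n ≤ m ^ k → Σ (Fin n → Fin k → Fin m) InjectiveWords
≤⇒InjectiveWords {k = k} {m} n≤m^k = (λ i → finToFun (inject≤ i n≤m^k)) , λ {i} {i′} eq →
  inject≤-injective n≤m^k n≤m^k i i′
    (trans (sym (funToFin-finToFin {k} {m} _)) (trans (funToFin-cong eq) (funToFin-finToFin {k} {m} _)))

module _ {V : Set} {Adj : V → V → Set} where

  _◅◅_ : ∀ {u v w l l′} → Walk Adj u v l → Walk Adj v w l′ → Walk Adj u w (l + l′)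
  here     ◅◅ q = q
  step a p ◅◅ q = step a (p ◅◅ q)

  reverse : (∀ {u v} → Adj u v → Adj v u) → ∀ {u v l} → Walk Adj u v l → Walk Adj v u l
  reverse adj-sym here = here
  reverse adj-sym (step {l = l} a p) =
    subst (Walk Adj _ _) (+-comm l 1) (reverse adj-sym p ◅◅ step (adj-sym a) here)

gmap : ∀ {V W : Set} {AdjV : V → V → Set} {AdjW : W → W → Set} (f : V → W) →
       (∀ {u v} → AdjV u v → AdjW (f u) (f v)) →
       ∀ {u v l} → Walk AdjV u v l → Walk AdjW (f u) (f v) l
gmap f f-adj here       = here
gmap f f-adj (step a p) = step (f-adj a) (gmap f f-adj p)

SameCode⇒colour≡ : ∀ {V : Set} {Adj : V → V → Set} {m} (c : V → Fin m) {u v} →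
                   SameCode Adj c u v → c u ≡ c v
SameCode⇒colour≡ c {u} same
  with proj₁ (same (c u) 0) ((u , refl , (here , λ _ _ → z≤n)) , λ _ _ _ _ → z≤n)
... | (_ , cu≡cv , (here , _)) , _ = sym cu≡cv

ClassDist-resp-≗ : ∀ {V : Set} {Adj : V → V → Set} {m} {c c′ : V → Fin m} → (∀ v → c v ≡ c′ v) →
                   ∀ {u x d} → ClassDist Adj c u x d → ClassDist Adj c′ u x d
ClassDist-resp-≗ c≗c′ ((w , cw , D) , nearest) =
  (w , trans (sym (c≗c′ w)) cw , D) , λ w′ d′ cw′ D′ → nearest w′ d′ (trans (c≗c′ w′) cw′) D′

Locating-resp-≗ : ∀ {V : Set} {Adj : V → V → Set} {m} {c c′ : V → Fin m} → (∀ v → c v ≡ c′ v) →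
                  Locating Adj c → Locating Adj c′
Locating-resp-≗ c≗c′ (proper , separating) =
  (λ {u} {v} a c′u≡c′v → proper a (trans (c≗c′ u) (trans c′u≡c′v (sym (c≗c′ v))))) ,
  λ u v same → separating u v λ x d →
    (ClassDist-resp-≗ (sym ∘ c≗c′) ∘ proj₁ (same x d) ∘ ClassDist-resp-≗ c≗c′) ,
    (ClassDist-resp-≗ (sym ∘ c≗c′) ∘ proj₂ (same x d) ∘ ClassDist-resp-≗ c≗c′)

module Automorphism {V : Set} {Adj : V → V → Set} (σ σ⁻¹ : V → V)
  (σ⁻¹∘σ : ∀ v → σ⁻¹ (σ v) ≡ v) (σ∘σ⁻¹ : ∀ v → σ (σ⁻¹ v) ≡ v)
  (σ-adj : ∀ {u v} → Adj u v → Adj (σ u) (σ v)) (σ⁻¹-adj : ∀ {u v} → Adj u v → Adj (σ⁻¹ u) (σ⁻¹ v))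
  where

  Dist-σ : ∀ {u v d} → Dist Adj u v d → Dist Adj (σ u) (σ v) d
  Dist-σ {u} {v} (p , shortest) = gmap σ σ-adj p , λ l q →
    shortest l (subst₂ (λ a b → Walk Adj a b l) (σ⁻¹∘σ u) (σ⁻¹∘σ v) (gmap σ⁻¹ σ⁻¹-adj q))

  Dist-σ⁻¹ : ∀ {u w d} → Dist Adj (σ u) w d → Dist Adj u (σ⁻¹ w) d
  Dist-σ⁻¹ {u} {w} (p , shortest) =
    subst (λ a → Walk Adj a (σ⁻¹ w) _) (σ⁻¹∘σ u) (gmap σ⁻¹ σ⁻¹-adj p) , λ l q →
    shortest l (subst (λ a → Walk Adj (σ u) a l) (σ∘σ⁻¹ w) (gmap σ σ-adj q))

  module _ {m : ℕ} (c : V → Fin m) (c∘σ : ∀ v → c (σ v) ≡ c v) where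

    c∘σ⁻¹ : ∀ v → c (σ⁻¹ v) ≡ c v
    c∘σ⁻¹ v = trans (sym (c∘σ (σ⁻¹ v))) (cong c (σ∘σ⁻¹ v))

    ClassDist-σ : ∀ {u x d} → ClassDist Adj c u x d → ClassDist Adj c (σ u) x d
    ClassDist-σ ((w , cw , D) , nearest) =
      (σ w , trans (c∘σ w) cw , Dist-σ D) ,
      λ w′ d′ cw′ D′ → nearest (σ⁻¹ w′) d′ (trans (c∘σ⁻¹ w′) cw′) (Dist-σ⁻¹ D′)

    ClassDist-σ⁻¹ : ∀ {u x d} → ClassDist Adj c (σ u) x d → ClassDist Adj c u x d
    ClassDist-σ⁻¹ ((w , cw , D) , nearest) =
      (σ⁻¹ w , trans (c∘σ⁻¹ w) cw , Dist-σ⁻¹ D) ,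
      λ w′ d′ cw′ D′ → nearest (σ w′) d′ (trans (c∘σ w′) cw′) (Dist-σ D′)

    SameCode-σ : ∀ u → SameCode Adj c u (σ u)
    SameCode-σ u x d = ClassDist-σ , ClassDist-σ⁻¹

module Metric {V : Set} {Adj : V → V → Set} (d : V → V → ℕ)
  (walk : ∀ u v → Walk Adj u v (d u v))
  (walk-length : ∀ {u v l} → Walk Adj u v l → d u v ≤ l)
  where

  Dist-d : ∀ u v → Dist Adj u v (d u v)
  Dist-d u v = walk u v , λ _ → walk-length

  Dist⇒≡d : ∀ {u v e} → Dist Adj u v e → e ≡ d u v
  Dist⇒≡d (p , shortest) = ≤-antisym (shortest _ (walk _ _)) (walk-length p)

  Nearest : ∀ {m} → (V → Fin m) → V → Fin m → ℕ → Set
  Nearest c u x e = Σ V (λ w → c w ≡ x × d u w ≡ e) × (∀ w → c w ≡ x → e ≤ d u w)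

  module _ {m : ℕ} {c : V → Fin m} {u : V} {x : Fin m} {e : ℕ} where

    ClassDist⇒Nearest : ClassDist Adj c u x e → Nearest c u x e
    ClassDist⇒Nearest ((w , cw , D) , nearest) =
      (w , cw , sym (Dist⇒≡d D)) , λ w′ cw′ → nearest w′ _ cw′ (Dist-d u w′)

    Nearest⇒ClassDist : Nearest c u x e → ClassDist Adj c u x e
    Nearest⇒ClassDist ((w , cw , refl) , nearest) =
      (w , cw , Dist-d u w) , λ w′ d′ cw′ D′ → subst (e ≤_) (sym (Dist⇒≡d D′)) (nearest w′ cw′)

    ClassDist⇒attained : ClassDist Adj c u x e → Σ V λ w → e ≡ d u w
    ClassDist⇒attained ((w , _ , D) , _) = w , Dist⇒≡d D

module Enumerated {V : Set} {N : ℕ} (index : V → Fin N) (enum : Fin N → V)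
  (enum∘index : ∀ v → enum (index v) ≡ v)
  where

  ∀? : {P : V → Set} → (∀ v → Dec (P v)) → Dec (∀ v → P v)
  ∀? {P} P? = map′ (λ all v → subst P (enum∘index v) (all (index v))) (λ all → all ∘ enum)
                   (all? (P? ∘ enum))

  ∃? : {P : V → Set} → (∀ v → Dec (P v)) → Dec (Σ V P)
  ∃? {P} P? = map′ (λ (i , p) → enum i , p) (λ (v , p) → index v , subst P (sym (enum∘index v)) p)
                   (any? (P? ∘ enum))

  _≟ⱽ_ : (u v : V) → Dec (u ≡ v)
  u ≟ⱽ v = map′ (λ eq → trans (sym (enum∘index u)) (trans (cong enum eq) (enum∘index v)))
               (cong index) (index u ≟ᶠ index v)

  ∃-colouring? : ∀ {m} {P : (V → Fin m) → Set} → (∀ c → Dec (P c)) →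
                 (∀ {c c′} → (∀ v → c v ≡ c′ v) → P c → P c′) → Dec (Σ (V → Fin m) P)
  ∃-colouring? {m} {P} P? P-resp-≗ =
    map′ (λ (f , p) → finToFun f ∘ index , p) from (any? (λ f → P? (finToFun f ∘ index)))
    where
    from : Σ (V → Fin m) P → Σ (Fin (m ^ N)) (λ f → P (finToFun f ∘ index))
    from (c , p) = funToFin (c ∘ enum) , P-resp-≗ restore p
      where
      restore : ∀ v → c v ≡ finToFun (funToFin (c ∘ enum)) (index v)
      restore v = sym (trans (finToFun-funToFin (c ∘ enum) (index v)) (cong c (enum∘index v)))

module FiniteMetricGraph {V : Set} {Adj : V → V → Set} (Adj? : ∀ u v → Dec (Adj u v))
  {N : ℕ} (index : V → Fin N) (enum : Fin N → V) (enum∘index : ∀ v → enum (index v) ≡ v)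
  (d : V → V → ℕ) (walk : ∀ u v → Walk Adj u v (d u v))
  (walk-length : ∀ {u v l} → Walk Adj u v l → d u v ≤ l)
  where

  open Enumerated index enum enum∘index
  open Metric d walk walk-length

  module _ {m : ℕ} (c : V → Fin m) where

    ClassDist? : ∀ u x e → Dec (ClassDist Adj c u x e)
    ClassDist? u x e = map′ Nearest⇒ClassDist ClassDist⇒Nearest
      (∃? (λ w → (c w ≟ᶠ x) ×-dec (d u w ≟ e)) ×-dec ∀? (λ w → (c w ≟ᶠ x) →-dec (e ≤? d u w)))

    Agree : V → V → Fin m → ℕ → Set
    Agree u v x e = (ClassDist Adj c u x e → ClassDist Adj c v x e) ×
                    (ClassDist Adj c v x e → ClassDist Adj c u x e)

    Agree? : ∀ u v x e → Dec (Agree u v x e)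
    Agree? u v x e = (ClassDist? u x e →-dec ClassDist? v x e) ×-dec (ClassDist? v x e →-dec ClassDist? u x e)

    -- A class distance is always the distance to some vertex, so only finitely many values matter.
    AgreeAtVertices : V → V → Set
    AgreeAtVertices u v = ∀ x w → Agree u v x (d u w) × Agree u v x (d v w)

    AgreeAtVertices⇒SameCode : ∀ {u v} → AgreeAtVertices u v → SameCode Adj c u v
    AgreeAtVertices⇒SameCode {u} {v} agree x e = to , from
      where
      to : ClassDist Adj c u x e → ClassDist Adj c v x e
      to cd = let (w , e≡) = ClassDist⇒attained cd in
        subst (ClassDist Adj c v x) (sym e≡) (proj₁ (proj₁ (agree x w)) (subst (ClassDist Adj c u x) e≡ cd))
      from : ClassDist Adj c v x e → ClassDist Adj c u x e
      from cd = let (w , e≡) = ClassDist⇒attained cd in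
        subst (ClassDist Adj c u x) (sym e≡) (proj₂ (proj₂ (agree x w)) (subst (ClassDist Adj c v x) e≡ cd))

    SameCode? : ∀ u v → Dec (SameCode Adj c u v)
    SameCode? u v = map′ AgreeAtVertices⇒SameCode (λ same x w → same x (d u w) , same x (d v w))
      (all? λ x → ∀? λ w → Agree? u v x (d u w) ×-dec Agree? u v x (d v w))

    Locating? : Dec (Locating Adj c)
    Locating? =
      map′ (λ proper {u} {v} → proper u v) (λ proper u v → proper)
           (∀? λ u → ∀? λ v → Adj? u v →-dec ¬? (c u ≟ᶠ c v))
      ×-dec ∀? (λ u → ∀? λ v → SameCode? u v →-dec (u ≟ⱽ v))

  IsLocChromNum-exists : ∀ {M} → Σ (V → Fin M) (Locating Adj) → Σ ℕ λ χ → IsLocChromNum Adj χ × χ ≤ M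
  IsLocChromNum-exists located =
    let χ , located-χ , χ≤M , fewer = least-satisfying (λ m → ∃-colouring? Locating? Locating-resp-≗) located
    in χ , (located-χ , λ m′ m′<χ c′ loc′ → fewer m′ m′<χ (c′ , loc′)) , χ≤M

module Palm {n k : ℕ} where

  depth : PalmV n k → ℕ
  depth hub        = 0
  depth (node _ j) = suc (toℕ j)

  dist : PalmV n k → PalmV n k → ℕ
  dist hub        v            = depth v
  dist (node i j) hub          = suc (toℕ j)
  dist (node i j) (node i′ j′) with i ≟ᶠ i′
  ... | yes _ = ∣ toℕ j - toℕ j′ ∣
  ... | no  _ = suc (toℕ j) + suc (toℕ j′)

  dist-same-leg : ∀ i j j′ → dist (node i j) (node i j′) ≡ ∣ toℕ j - toℕ j′ ∣
  dist-same-leg i j j′ with i ≟ᶠ i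
  ... | yes _ = refl
  ... | no i≢i = contradiction refl i≢i

  dist-other-leg : ∀ {i i′} → i ≢ i′ → ∀ j j′ → dist (node i j) (node i′ j′) ≡ suc (toℕ j) + suc (toℕ j′)
  dist-other-leg {i} {i′} i≢i′ j j′ with i ≟ᶠ i′
  ... | yes i≡i′ = contradiction i≡i′ i≢i′
  ... | no _ = refl

  ∣-∣≤dist : ∀ i i′ j j′ → ∣ toℕ j - toℕ j′ ∣ ≤ dist (node i j) (node i′ j′)
  ∣-∣≤dist i i′ j j′ with i ≟ᶠ i′
  ... | yes _ = ≤-refl
  ... | no  _ = <⇒≤ (∣-∣<1+m+1+n (toℕ j) (toℕ j′))

  dist-self : ∀ v → dist v v ≡ 0
  dist-self hub        = refl
  dist-self (node i j) = trans (dist-same-leg i j j) (∣n-n∣≡0 (toℕ j))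

  dist-edge : ∀ {u w} → PalmEdge u w → ∀ v → dist u v ≤ suc (dist w v) × dist w v ≤ suc (dist u v)
  dist-edge (e-hub i j j≡0) hub rewrite j≡0 = z≤n , ≤-refl
  dist-edge (e-hub i j j≡0) (node i′ j′) with i ≟ᶠ i′
  ... | yes _ rewrite j≡0 = ≤-refl , m≤n+m _ 2
  ... | no  _ rewrite j≡0 = m≤n+m _ 2 , ≤-refl
  dist-edge (e-path i j j′ 1+j≡j′) hub rewrite sym 1+j≡j′ = m≤n+m _ 2 , ≤-refl
  dist-edge (e-path i j j′ 1+j≡j′) (node i″ j″) with i ≟ᶠ i″
  ... | yes _ = ∣-∣-step (toℕ j) (toℕ j′) (toℕ j″) ∣j-j′∣≡1 ,
                ∣-∣-step (toℕ j′) (toℕ j) (toℕ j″) (trans (∣-∣-comm (toℕ j′) (toℕ j)) ∣j-j′∣≡1)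
    where
    ∣j-j′∣≡1 : ∣ toℕ j - toℕ j′ ∣ ≡ 1
    ∣j-j′∣≡1 = subst (λ t → ∣ toℕ j - t ∣ ≡ 1) 1+j≡j′ (∣n-1+n∣≡1 (toℕ j))
  ... | no _ rewrite sym 1+j≡j′ = m≤n+m _ 2 , ≤-refl

  dist-adj : ∀ {u w} → PalmAdj n k u w → ∀ v → dist u v ≤ suc (dist w v)
  dist-adj (inj₁ e) v = proj₁ (dist-edge e v)
  dist-adj (inj₂ e) v = proj₂ (dist-edge e v)

  walk-length : ∀ {u v l} → Walk (PalmAdj n k) u v l → dist u v ≤ l
  walk-length {u} here           = ≤-reflexive (dist-self u)
  walk-length {v = v} (step a p) = ≤-trans (dist-adj a v) (s≤s (walk-length p))

  PalmAdj-sym : ∀ {u v} → PalmAdj n k u v → PalmAdj n k v u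
  PalmAdj-sym (inj₁ e) = inj₂ e
  PalmAdj-sym (inj₂ e) = inj₁ e

  climb : ∀ i (j j′ : Fin k) t → toℕ j + t ≡ toℕ j′ → Walk (PalmAdj n k) (node i j) (node i j′) t
  climb i j j′ zero j+0≡j′ rewrite toℕ-injective (trans (sym (+-identityʳ (toℕ j))) j+0≡j′) = here
  climb i j j′ (suc t) j+1+t≡j′ =
    step (inj₁ (e-path i j next (sym (toℕ-fromℕ< 1+j<k))))
         (climb i next j′ t (trans (cong (_+ t) (toℕ-fromℕ< 1+j<k)) (trans (sym (+-suc (toℕ j) t)) j+1+t≡j′)))
    where
    1+j<k : suc (toℕ j) < k
    1+j<k = ≤-trans (s≤s (≤-trans (s≤s (m≤m+n (toℕ j) t))
                                  (≤-reflexive (trans (sym (+-suc (toℕ j) t)) j+1+t≡j′))))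
                    (toℕ<n j′)
    next : Fin k
    next = fromℕ< 1+j<k

  leg-walk : ∀ i (j : Fin k) → Walk (PalmAdj n k) hub (node i j) (suc (toℕ j))
  leg-walk i j = step (inj₁ (e-hub i first (toℕ-fromℕ< 0<k)))
                      (climb i first j (toℕ j) (cong (_+ toℕ j) (toℕ-fromℕ< 0<k)))
    where
    0<k : 0 < k
    0<k = ≤-trans (s≤s z≤n) (toℕ<n j)
    first : Fin k
    first = fromℕ< 0<k

  dist-walk : ∀ u v → Walk (PalmAdj n k) u v (dist u v)
  dist-walk hub        hub        = here
  dist-walk hub        (node i j) = leg-walk i j
  dist-walk (node i j) hub        = reverse PalmAdj-sym (leg-walk i j)
  dist-walk (node i j) (node i′ j′) with i ≟ᶠ i′
  ... | no _ = reverse PalmAdj-sym (leg-walk i j) ◅◅ leg-walk i′ j′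
  ... | yes refl with ≤-total (toℕ j) (toℕ j′)
  ...   | inj₁ j≤j′ = subst (Walk (PalmAdj n k) _ _) (sym (m≤n⇒∣m-n∣≡n∸m j≤j′))
                        (climb i j j′ _ (m+[n∸m]≡n j≤j′))
  ...   | inj₂ j′≤j = subst (Walk (PalmAdj n k) _ _) (sym (m≤n⇒∣n-m∣≡n∸m j′≤j))
                        (reverse PalmAdj-sym (climb i j′ j _ (m+[n∸m]≡n j′≤j)))

  index : PalmV n k → Fin (suc (n * k))
  index hub        = fzero
  index (node i j) = fsuc (combine i j)

  enum : Fin (suc (n * k)) → PalmV n k
  enum fzero    = hub
  enum (fsuc x) = uncurry node (remQuot k x)

  enum∘index : ∀ v → enum (index v) ≡ v
  enum∘index hub        = refl
  enum∘index (node i j) = cong (uncurry node) (remQuot-combine i j)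

  PalmEdge? : (u v : PalmV n k) → Dec (PalmEdge u v)
  PalmEdge? hub        hub        = no λ ()
  PalmEdge? hub        (node i j) = map′ (e-hub i j) (λ { (e-hub _ _ j≡0) → j≡0 }) (toℕ j ≟ 0)
  PalmEdge? (node _ _) hub        = no λ ()
  PalmEdge? (node i j) (node i′ j′) with i ≟ᶠ i′
  ... | no i≢i′  = no λ { (e-path _ _ _ _) → i≢i′ refl }
  ... | yes refl = map′ (e-path i j j′) (λ { (e-path _ _ _ 1+j≡j′) → 1+j≡j′ }) (suc (toℕ j) ≟ toℕ j′)

  PalmAdj? : ∀ u v → Dec (PalmAdj n k u v)
  PalmAdj? u v = PalmEdge? u v ⊎-dec PalmEdge? v u

  relabel-legs : (Fin n → Fin n) → PalmV n k → PalmV n k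
  relabel-legs f hub        = hub
  relabel-legs f (node i j) = node (f i) j

  relabel-legs-edge : ∀ f {u v} → PalmEdge u v → PalmEdge (relabel-legs f u) (relabel-legs f v)
  relabel-legs-edge f (e-hub i j j≡0)        = e-hub (f i) j j≡0
  relabel-legs-edge f (e-path i j j′ 1+j≡j′) = e-path (f i) j j′ 1+j≡j′

  relabel-legs-adj : ∀ f {u v} → PalmAdj n k u v → PalmAdj n k (relabel-legs f u) (relabel-legs f v)
  relabel-legs-adj f = Sum.map (relabel-legs-edge f) (relabel-legs-edge f)

  relabel-legs-inverse : ∀ {f g} → (∀ i → g (f i) ≡ i) → ∀ v → relabel-legs g (relabel-legs f v) ≡ v
  relabel-legs-inverse g∘f hub        = refl
  relabel-legs-inverse g∘f (node i j) = cong (λ l → node l j) (g∘f i)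

  node-injectiveˡ : ∀ {i i′ j j′} → node {n} {k} i j ≡ node i′ j′ → i ≡ i′
  node-injectiveˡ refl = refl

module _ {n k m : ℕ} {c : PalmV n k → Fin m} where
  open Palm {n} {k}

  Locating⇒InjectiveWords : Locating (PalmAdj n k) c → Fin k → InjectiveWords (λ i j → c (node i j))
  Locating⇒InjectiveWords (_ , separating) j {i} {i′} same-words =
    trans (node-injectiveˡ (separating (node i j) (σ (node i j)) (SameCode-σ c c∘σ (node i j))))
          (transpose-from i i′)
    where
    π : Permutation′ n
    π = transpose i i′
    σ σ⁻¹ : PalmV n k → PalmV n k
    σ   = relabel-legs (π ⟨$⟩ʳ_)
    σ⁻¹ = relabel-legs (π ⟨$⟩ˡ_)
    σ⁻¹∘σ : ∀ v → σ⁻¹ (σ v) ≡ v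
    σ⁻¹∘σ = relabel-legs-inverse {f = π ⟨$⟩ʳ_} {g = π ⟨$⟩ˡ_} (λ _ → inverseˡ π)
    σ∘σ⁻¹ : ∀ v → σ (σ⁻¹ v) ≡ v
    σ∘σ⁻¹ = relabel-legs-inverse {f = π ⟨$⟩ˡ_} {g = π ⟨$⟩ʳ_} (λ _ → inverseʳ π)
    open Automorphism {Adj = PalmAdj n k} σ σ⁻¹ σ⁻¹∘σ σ∘σ⁻¹ (relabel-legs-adj _) (relabel-legs-adj _)
    c∘σ : ∀ v → c (σ v) ≡ c v
    c∘σ hub        = refl
    c∘σ (node l p) = transpose-resp (λ l → c (node l p)) (same-words p) l

  Locating⇒n≤m^k : 0 < k → Locating (PalmAdj n k) c → n ≤ m ^ k
  Locating⇒n≤m^k 0<k loc = InjectiveWords⇒≤ (Locating⇒InjectiveWords loc (fromℕ< 0<k))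

module PalmColouring {n k q : ℕ} (w : Fin n → Fin k → Fin q) (w-inj : InjectiveWords w) where
  open Palm {n} {k}
  open Metric dist dist-walk walk-length

  colour : PalmV n k → Fin (suc (k * q))
  colour hub        = fzero
  colour (node i j) = fsuc (combine j (w i j))

  colour⁻¹ : ∀ v {p y} → colour v ≡ fsuc (combine p y) → Σ (Fin n) λ l → v ≡ node l p × w l p ≡ y
  colour⁻¹ (node l p′) cv≡ with refl , wlp≡y ← combine-injective p′ _ _ _ (fsuc-injective cv≡) = l , refl , wlp≡y

  colour-proper : Proper (PalmAdj n k) colour
  colour-proper (inj₁ (e-hub _ _ _)) ()
  colour-proper (inj₂ (e-hub _ _ _)) ()
  colour-proper (inj₁ (e-path i j j′ 1+j≡j′)) cu≡cv
    with refl , _ ← combine-injective j _ j′ _ (fsuc-injective cu≡cv) = 1+n≢n 1+j≡j′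
  colour-proper (inj₂ (e-path i j j′ 1+j≡j′)) cu≡cv
    with refl , _ ← combine-injective j′ _ j _ (fsuc-injective cu≡cv) = 1+n≢n 1+j≡j′

  nearest-on-leg : ∀ i j p → Nearest colour (node i j) (colour (node i p)) ∣ toℕ j - toℕ p ∣
  nearest-on-leg i j p = (node i p , refl , dist-same-leg i j p) , λ v cv →
    let l , v≡ , _ = colour⁻¹ v cv in subst (λ v → _ ≤ dist (node i j) v) (sym v≡) (∣-∣≤dist i l j p)

  not-nearest-off-leg : ∀ {i i′} j p → w i p ≢ w i′ p →
                        ¬ Nearest colour (node i′ j) (colour (node i p)) ∣ toℕ j - toℕ p ∣
  not-nearest-off-leg {i} {i′} j p wip≢wi′p ((v , cv , dist≡) , _)
    with l , refl , wlp≡wip ← colour⁻¹ v cv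
       | l ≟ᶠ i′
  ... | yes refl = wip≢wi′p (sym wlp≡wip)
  ... | no l≢i′  =
    <⇒≢ (∣-∣<1+m+1+n (toℕ j) (toℕ p)) (trans (sym dist≡) (dist-other-leg (l≢i′ ∘ sym) j p))

  colour-separating : ∀ u v → SameCode (PalmAdj n k) colour u v → u ≡ v
  colour-separating u v same with SameCode⇒colour≡ colour same
  colour-separating hub        hub          _    | _ = refl
  colour-separating (node i j) (node i′ j′) same | cu≡cv
    with refl , _ ← combine-injective j _ j′ _ (fsuc-injective cu≡cv)
       | i ≟ᶠ i′
  ... | yes refl = refl
  ... | no i≢i′  =
    let p , wip≢wi′p = ¬∀⟶∃¬ k _ (λ p → w i p ≟ᶠ w i′ p) (i≢i′ ∘ w-inj)
    in contradiction (ClassDist⇒Nearest (proj₁ (same _ _) (Nearest⇒ClassDist (nearest-on-leg i j p))))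
                     (not-nearest-off-leg j p wip≢wi′p)

  colour-locating : Locating (PalmAdj n k) colour
  colour-locating = colour-proper , colour-separating

palm-χL-exists : ∀ {n k q} → n ≤ q ^ k → Σ ℕ λ χ → IsLocChromNum (PalmAdj n k) χ × χ ≤ suc (k * q)
palm-χL-exists {n} {k} {q} n≤q^k = IsLocChromNum-exists (colour , colour-locating)
  where
  open Palm {n} {k}
  open FiniteMetricGraph PalmAdj? index enum enum∘index dist dist-walk walk-length
  words : Σ (Fin n → Fin k → Fin q) InjectiveWords
  words = ≤⇒InjectiveWords n≤q^k
  open PalmColouring (proj₁ words) (proj₂ words)

palm-χL-bounds : ∀ {n k} → 0 < k → 2 ≤ n →
                 Σ ℕ λ χ → IsLocChromNum (PalmAdj n k) χ × n ≤ χ ^ k × χ ^ k ≤ (4 * k) ^ k * n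
palm-χL-bounds 0<k 2≤n =
  let r , n≤[2+r]^k , [1+r]^k<n = root-bracket 0<k 2≤n
      χ , χ-is-χL , χ≤1+k[2+r] = palm-χL-exists n≤[2+r]^k
  in χ , χ-is-χL , Locating⇒n≤m^k 0<k (proj₂ (proj₁ χ-is-χL)) , χ^k≤[4k]^k*n 0<k χ≤1+k[2+r] [1+r]^k<n

theorem11 : (k : ℕ) → 1 ≤ k →
    Σ ℕ (λ a → Σ ℕ (λ b → Σ ℕ (λ N → 1 ≤ a × 1 ≤ b ×
      ((n : ℕ) → N ≤ n →
        Σ ℕ (λ χ → IsLocChromNum (PalmAdj n k) χ
                   × n ≤ a * χ ^ k
                   × χ ^ k ≤ b * n)))))
theorem11 k 1≤k = 1 , (4 * k) ^ k , 2 , ≤-refl , 1≤[4k]^k , λ n 2≤n →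
  let χ , χ-is-χL , n≤χ^k , χ^k≤4k^k*n = palm-χL-bounds 1≤k 2≤n
  in χ , χ-is-χL , subst (n ≤_) (sym (*-identityˡ (χ ^ k))) n≤χ^k , χ^k≤4k^k*n
  where
  1≤[4k]^k : 1 ≤ (4 * k) ^ k
  1≤[4k]^k = subst (_≤ (4 * k) ^ k) (^-zeroˡ k) (^-monoˡ-≤ k (≤-trans 1≤k (m≤n*m k 4)))
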